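{- Let $m(\mathbf{x},\mathbf{y})=x^py^q\in\mathcal{O}_n$ with signed index permutation $\sigma\in B_n$. Then $\{p_i-f_i(\sigma^{ -1})\}_{i=1}^n$ is a (weakly) decreasing sequence of non-negative even integers.
   Context: $B_n$ is the group of bijections $\sigma$ of $\{ -n,\dots,-1,1,\dots,n\}$ with $\sigma(-k)=-\sigma(k)$. For $\tau\in B_n$: $\mathrm{Des}(\tau)=\{1\le i\le n-1:\tau(i)>\tau(i+1)\}$; $d_i(\tau)=|\{j\in\mathrm{Des}(\tau):j\ge i\}|$; $\varepsilon_i(\tau)=0$ if $\tau(i)>0$, $1$ if $\tau(i)<0$; $f_i(\tau)=2d_i(\tau)+\varepsilon_i(\tau)$. For non-negative integer sequences $p,q$, $x^py^q=\prod x_i^{p_i}y_i^{q_i}$. Let $\mathfrak{s}(a)=a$ if $a$ is even and $-a$ if $a$ is odd. $\mathcal{O}_n$ is the set of monomials $x^py^q$ with $p_k+q_k$ even for all $k$ and $(p_1,\mathfrak{s}(q_1))\ge_\ell\cdots\ge_\ell(p_n,\mathfrak{s}(q_n))$ lexicographically. The signed index permutation of $x^py^q\in\mathcal{O}_n$ is the unique $\sigma\in B_n$ with: (1) $q_{|\sigma(1)|}\ge\cdots\ge q_{|\sigma(n)|}$; (2) if $0<i<j$ and $q_{|\sigma(i)|}=q_{|\sigma(j)|}$ then $\sigma(i)<\sigma(i+1)<\cdots<\sigma(j)$; (3) $q_{|\sigma(i)|}$ is even iff $\sigma(i)>0$. -}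

module Defs where

open import Data.Nat as ℕ using (ℕ; zero; suc; _+_; _*_; _∸_; _<?_)
import Data.Nat.Divisibility as ℕD
open import Data.Integer as ℤ using (ℤ; +_; -[1+_])
open import Data.Fin as Fin using (Fin; toℕ; fromℕ<)
open import Data.Fin.Permutation using (Permutation′; _⟨$⟩ʳ_; _⟨$⟩ˡ_; flip)
open import Data.Bool using (Bool; true; false; if_then_else_)
open import Data.List using (List; length; filter; upTo)
open import Data.Product using (_×_; _,_)
open import Data.Sum using (_⊎_)
open import Relation.Nullary using (Dec; yes; no)
open import Relation.Nullary.Decidable using (_×-dec_)
open import Relation.Binary.PropositionalEquality using (_≡_)

-- A signed permutation σ ∈ B_n is encoded by a permutation π of Fin n and
-- a sign vector neg : Fin n → Bool.  For 1 ≤ k ≤ n (index k is the element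
-- i : Fin n with toℕ i = k - 1) we have
--   σ(k) = -(π(i)+1)  if neg i = true,   σ(k) = π(i)+1  otherwise,
-- and σ(-k) = -σ(k).  This is a bijection with B_n.

record SignedPerm (n : ℕ) : Set where
  constructor sperm
  field
    perm : Permutation′ n
    neg  : Fin n → Bool
open SignedPerm public

sval : ∀ {n} → SignedPerm n → Fin n → ℤ
sval σ i with neg σ i
... | true  = -[1+ toℕ (perm σ ⟨$⟩ʳ i) ]
... | false = + suc (toℕ (perm σ ⟨$⟩ʳ i))

absIdx : ∀ {n} → SignedPerm n → Fin n → Fin n
absIdx σ i = perm σ ⟨$⟩ʳ i

sinv : ∀ {n} → SignedPerm n → SignedPerm n
sinv σ = sperm (flip (perm σ)) (λ j → neg σ (perm σ ⟨$⟩ˡ j))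

-- 1-based value τ(k) for 1 ≤ k ≤ n (value 0 outside this range, never used)
val : ∀ {n} → SignedPerm n → ℕ → ℤ
val {n} τ zero = + 0
val {n} τ (suc k) with k <? n
... | yes k<n = sval τ (fromℕ< k<n)
... | no  _   = + 0

IsDes : ∀ {n} → SignedPerm n → ℕ → Set
IsDes {n} τ i = (1 ℕ.≤ i) × (i ℕ.≤ n ∸ 1) × (val τ (suc i) ℤ.< val τ i)

isDes? : ∀ {n} (τ : SignedPerm n) (i : ℕ) → Dec (IsDes τ i)
isDes? {n} τ i = (1 ℕ.≤? i) ×-dec ((i ℕ.≤? n ∸ 1) ×-dec (val τ (suc i) ℤ.<? val τ i))

-- d_i(τ) = |{ j ∈ Des(τ) : j ≥ i }|   (all descents lie in {1,…,n-1} ⊆ upTo n)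
dStat : ∀ {n} → SignedPerm n → ℕ → ℕ
dStat {n} τ i = length (filter (λ j → isDes? τ j ×-dec (i ℕ.≤? j)) (upTo n))

εStat : ∀ {n} → SignedPerm n → ℕ → ℕ
εStat τ i with ℤ.+0 ℤ.<? val τ i
... | yes _ = 0
... | no  _ = 1

fStat : ∀ {n} → SignedPerm n → ℕ → ℕ
fStat τ i = 2 * dStat τ i + εStat τ i

-- Monomials x^p y^q, with exponent sequences p, q : Fin n → ℕ
-- (p (i) is the exponent of x_{i+1}).

𝔰 : ℕ → ℤ
𝔰 a with ℕD._∣?_ 2 a
... | yes _ = + a
... | no  _ = ℤ.- (+ a)

_≥ℓ_ : (ℕ × ℤ) → (ℕ × ℤ) → Set
(a , b) ≥ℓ (c , d) = (c ℕ.< a) ⊎ ((a ≡ c) × (d ℤ.≤ b))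

-- x^p y^q ∈ 𝒪_n.  The chain (p₁,𝔰(q₁)) ≥ℓ ⋯ ≥ℓ (pₙ,𝔰(qₙ)) is written pairwise.
InO : (n : ℕ) → (Fin n → ℕ) → (Fin n → ℕ) → Set
InO n p q =
  (∀ k → 2 ℕD.∣ (p k + q k)) ×
  (∀ (i j : Fin n) → i Fin.≤ j → (p i , 𝔰 (q i)) ≥ℓ (p j , 𝔰 (q j)))

-- σ is the signed index permutation of x^p y^q (conditions (1)–(3));
-- chains are written pairwise.
IsSignedIndexPerm : ∀ {n} → (Fin n → ℕ) → SignedPerm n → Set
IsSignedIndexPerm {n} q σ =
  -- (1) q_{|σ(1)|} ≥ ⋯ ≥ q_{|σ(n)|}
  (∀ (i j : Fin n) → i Fin.≤ j → q (absIdx σ j) ℕ.≤ q (absIdx σ i)) ×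
  -- (2) i < j, q_{|σ(i)|} = q_{|σ(j)|}  ⇒  σ(i) < σ(i+1) < ⋯ < σ(j)
  (∀ (i j : Fin n) → i Fin.< j → q (absIdx σ i) ≡ q (absIdx σ j) →
     ∀ (k l : Fin n) → i Fin.≤ k → k Fin.< l → l Fin.≤ j → sval σ k ℤ.< sval σ l) ×
  -- (3) q_{|σ(i)|} even ⇔ σ(i) > 0
  (∀ (i : Fin n) → (2 ℕD.∣ q (absIdx σ i) → ℤ.+0 ℤ.< sval σ i)
                 × (ℤ.+0 ℤ.< sval σ i → 2 ℕD.∣ q (absIdx σ i)))

-- Write τ = σ⁻¹.  By condition (3), τ(i) < 0 exactly when q_i, equivalently p_i, is odd, so
-- ε_i(τ) = p_i mod 2 and p_i − f_i(τ) = 2 (⌊p_i/2⌋ − d_i(τ)), which is even.  Since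
-- d_i ≤ d_{i+1} + [i ∈ Des(τ)] and d_n = 0, it remains to see that ⌊p_{i+1}/2⌋ ≤ ⌊p_i/2⌋, strictly
-- when i is a descent of τ.  The weak inequality holds because p is weakly decreasing.  If the halves
-- agree, then either p_i = p_{i+1}, and the lexicographic order on 𝔰(q) together with conditions
-- (1) and (2) makes τ(i) < τ(i+1); or p_i = p_{i+1} + 1 with q_i odd and q_{i+1} even, so
-- τ(i) < 0 < τ(i+1).  Either way i is not a descent.
module Submission where

open import Level using (Level)
open import Function using (_∘_; _⇔_; mk⇔; Equivalence)
open import Function.Properties.Equivalence using () renaming (trans to ⇔-trans)
open import Data.Nat as ℕ using (ℕ; zero; suc; _+_; _*_; _∸_; _%_; _/_; z≤n; s≤s; _≤?_; _<?_; _≟_)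
open import Data.Nat.Properties as ℕ
  using (≤∧≢⇒<; <⇒≤; <⇒≢; <⇒≱; <-irrefl; <-asym; ≤-antisym; ≤-refl; n≤1+n; ≮⇒≥; n≮0; n<1⇒n≡0; <-cmp;
         +-suc; +-comm; +-mono-≤; +-monoˡ-≤; +-monoʳ-≤; *-monoˡ-≤; +-cancelʳ-<)
open import Data.Nat.DivMod using (m≡m%n+[m/n]*n; m%n<n; /-monoˡ-≤)
open import Data.Nat.Divisibility as ℕ∣ using (m%n≡0⇒n∣m; n∣m⇒m%n≡0; ∣m+n∣m⇒∣n; _∣?_; 1∣_)
open import Data.Integer as ℤ using (ℤ; +_; -[1+_]; -_; _-_; _⊖_; +<+; -<-; -<+)
import Data.Integer.Properties as ℤ
open import Data.Integer.Divisibility using (_∣_; *-monoˡ-∣)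
open import Data.Integer.Tactic.RingSolver using (solve-∀)
open import Data.Fin as Fin using (Fin; toℕ; fromℕ)
open import Data.Fin.Properties using (≤fromℕ; toℕ-fromℕ; toℕ-injective; toℕ<n; fromℕ<-toℕ)
open import Data.Fin.Permutation using (_⟨$⟩ˡ_; inverseʳ)
open import Data.Bool using (true; false)
open import Data.Empty using (⊥)
open import Data.List using (List; []; _∷_; length; filter; upTo)
open import Data.List.Properties using (filter-accept; filter-reject; filter-none)
open import Data.List.Relation.Unary.All as All using (All; []; _∷_)
open import Data.List.Relation.Unary.AllPairs using ([]; _∷_)
open import Data.List.Relation.Unary.Unique.Propositional using (Unique)
open import Data.List.Relation.Unary.Unique.Propositional.Properties using (upTo⁺)
open import Data.Product using (_×_; _,_; proj₁; proj₂; Σ-syntax)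
open import Data.Sum using (inj₁; inj₂)
open import Relation.Binary.Bundles using (Preorder)
open import Relation.Binary.Definitions using (tri<; tri≈; tri>)
open import Relation.Nullary using (Dec; yes; no; ¬_; contradiction)
open import Relation.Nullary.Decidable using (_×-dec_)
open import Relation.Unary using (Pred; Decidable)
open import Relation.Binary.PropositionalEquality

open import Defs

module _ {a b : Level} {A : Set} {Q : Pred A a} {R : Pred A b}
         (Q? : Decidable Q) (R? : Decidable R) where

  filter-∷-cong : ∀ {x xs ys} → (Q x ⇔ R x) → filter Q? xs ≡ filter R? ys →
                  filter Q? (x ∷ xs) ≡ filter R? (x ∷ ys)
  filter-∷-cong {x} Qx⇔Rx eq with Q? x
  ... | yes Qx = trans (cong (x ∷_) eq) (sym (filter-accept R? (Equivalence.to Qx⇔Rx Qx)))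
  ... | no ¬Qx = trans eq (sym (filter-reject R? (¬Qx ∘ Equivalence.from Qx⇔Rx)))

module _ {a : Level} {A : Set} {Q : Pred A a} (Q? : Decidable Q) where

  length-filter-∷ : ∀ x xs → length (filter Q? (x ∷ xs)) ℕ.≤ suc (length (filter Q? xs))
  length-filter-∷ x xs with Q? x
  ... | yes _ = ≤-refl
  ... | no  _ = n≤1+n _

module _ {ℓ : Level} {P : Pred ℕ ℓ} (P? : Decidable P) where

  atLeast : ℕ → List ℕ → List ℕ
  atLeast i = filter (λ j → P? j ×-dec (i ≤? j))

  atLeast-suc : ∀ {i} xs → All (λ j → P j → j ≢ i) xs → atLeast i xs ≡ atLeast (suc i) xs
  atLeast-suc [] [] = refl
  atLeast-suc (x ∷ xs) (x≢i ∷ h) =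
    filter-∷-cong (λ j → P? j ×-dec (_ ≤? j)) (λ j → P? j ×-dec (_ ≤? j))
      (mk⇔ (λ (Px , i≤x) → Px , ≤∧≢⇒< i≤x (x≢i Px ∘ sym)) (λ (Px , i<x) → Px , <⇒≤ i<x))
      (atLeast-suc xs h)

  length-atLeast-suc : ∀ {i xs} → Unique xs →
                       length (atLeast i xs) ℕ.≤ suc (length (atLeast (suc i) xs))
  length-atLeast-suc {i} {[]} [] = z≤n
  length-atLeast-suc {i} {x ∷ xs} (x∉xs ∷ u) with x ≟ i
  ... | yes refl = begin
    length (atLeast x (x ∷ xs))             ≤⟨ length-filter-∷ (λ j → P? j ×-dec (x ≤? j)) x xs ⟩
    suc (length (atLeast x xs))             ≡⟨ cong (suc ∘ length) (atLeast-suc xs (All.map (λ x≢j _ → x≢j ∘ sym) x∉xs)) ⟩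
    suc (length (atLeast (suc x) xs))       ≡⟨ cong (suc ∘ length) (filter-reject (λ j → P? j ×-dec (suc x ≤? j)) (<-irrefl refl ∘ proj₂)) ⟨
    suc (length (atLeast (suc x) (x ∷ xs))) ∎
    where open ℕ.≤-Reasoning
  ... | no x≢i = step (P? x ×-dec (suc i ≤? x))
    where
    open ℕ.≤-Reasoning
    Q? = λ j → P? j ×-dec (i ≤? j)
    R? = λ j → P? j ×-dec (suc i ≤? j)
    step : Dec (P x × suc i ℕ.≤ x) → length (atLeast i (x ∷ xs)) ℕ.≤ suc (length (atLeast (suc i) (x ∷ xs)))
    step (yes (Px , i<x)) = begin
      length (atLeast i (x ∷ xs))             ≡⟨ cong length (filter-accept Q? (Px , <⇒≤ i<x)) ⟩
      suc (length (atLeast i xs))             ≤⟨ s≤s (length-atLeast-suc u) ⟩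
      suc (suc (length (atLeast (suc i) xs))) ≡⟨ cong (suc ∘ length) (filter-accept R? (Px , i<x)) ⟨
      suc (length (atLeast (suc i) (x ∷ xs))) ∎
    step (no ¬Rx) = begin
      length (atLeast i (x ∷ xs))             ≡⟨ cong length (filter-reject Q? ¬Qx) ⟩
      length (atLeast i xs)                   ≤⟨ length-atLeast-suc u ⟩
      suc (length (atLeast (suc i) xs))       ≡⟨ cong (suc ∘ length) (filter-reject R? ¬Rx) ⟨
      suc (length (atLeast (suc i) (x ∷ xs))) ∎
      where
      ¬Qx : ¬ (P x × i ℕ.≤ x)
      ¬Qx (Px , i≤x) = ¬Rx (Px , ≤∧≢⇒< i≤x (x≢i ∘ sym))

¬2∣m⇒m%2≡1 : ∀ {m} → ¬ 2 ℕ∣.∣ m → m % 2 ≡ 1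
¬2∣m⇒m%2≡1 {m} ¬2∣m with m % 2 in eq | m%n<n m 2
... | 0           | _ = contradiction (m%n≡0⇒n∣m m 2 eq) ¬2∣m
... | 1           | _ = refl
... | suc (suc _) | s≤s (s≤s ())

m<n∧n/2≤m/2⇒2∣m∧2∤n : ∀ {m n} → m ℕ.< n → n / 2 ℕ.≤ m / 2 → 2 ℕ∣.∣ m × ¬ 2 ℕ∣.∣ n
m<n∧n/2≤m/2⇒2∣m∧2∤n {m} {n} m<n n/2≤m/2 =
  m%n≡0⇒n∣m m 2 (n<1⇒n≡0 (ℕ.≤-trans m%2<n%2 (ℕ.s≤s⁻¹ (m%n<n n 2)))) ,
  λ 2∣n → n≮0 (subst (m % 2 ℕ.<_) (n∣m⇒m%n≡0 n 2 2∣n) m%2<n%2)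
  where
  open ℕ.≤-Reasoning
  m%2<n%2 : m % 2 ℕ.< n % 2
  m%2<n%2 = +-cancelʳ-< (m / 2 * 2) (m % 2) (n % 2) (begin-strict
    m % 2 + m / 2 * 2 ≡⟨ m≡m%n+[m/n]*n m 2 ⟨
    m                 <⟨ m<n ⟩
    n                 ≡⟨ m≡m%n+[m/n]*n n 2 ⟩
    n % 2 + n / 2 * 2 ≤⟨ +-monoʳ-≤ (n % 2) (*-monoˡ-≤ 2 n/2≤m/2) ⟩
    n % 2 + m / 2 * 2 ∎)

m-[2d+m%2]≡[m/2-d]*2 : ∀ m d → + m - + (2 * d + m % 2) ≡ (+ (m / 2) - + d) ℤ.* + 2
m-[2d+m%2]≡[m/2-d]*2 m d = begin
  + m - + (2 * d + e)                      ≡⟨ cong (λ k → + k - + (2 * d + e)) (m≡m%n+[m/n]*n m 2) ⟩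
  + (e + h * 2) - + (2 * d + e)            ≡⟨ cong₂ _-_ (trans (ℤ.pos-+ e (h * 2)) (cong (λ z → + e ℤ.+ z) (ℤ.pos-* h 2)))
                                                        (trans (ℤ.pos-+ (2 * d) e) (cong (λ z → z ℤ.+ + e) (ℤ.pos-* 2 d))) ⟩
  (+ e ℤ.+ + h ℤ.* + 2) - (+ 2 ℤ.* + d ℤ.+ + e) ≡⟨ ring (+ e) (+ h) (+ d) ⟩
  (+ h - + d) ℤ.* + 2                      ∎
  where
  open ≡-Reasoning
  e = m % 2
  h = m / 2
  ring : ∀ x y z → (x ℤ.+ y ℤ.* + 2) - (+ 2 ℤ.* z ℤ.+ x) ≡ (y - z) ℤ.* + 2
  ring = solve-∀

m-n≤o-p : ∀ {m n o p} → p + m ℕ.≤ n + o → + m - + n ℤ.≤ + o - + p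
m-n≤o-p {m} {n} {o} {p} h = begin
  + m - + n             ≡⟨ ℤ.m-n≡m⊖n m n ⟩
  m ⊖ n                 ≡⟨ ℤ.+-cancelˡ-⊖ p m n ⟨
  (p + m) ⊖ (p + n)     ≤⟨ ℤ.⊖-monoˡ-≤ (p + n) h ⟩
  (n + o) ⊖ (p + n)     ≡⟨ cong ((n + o) ⊖_) (+-comm p n) ⟩
  (n + o) ⊖ (n + p)     ≡⟨ ℤ.+-cancelˡ-⊖ n o p ⟩
  o ⊖ p                 ≡⟨ ℤ.m-n≡m⊖n o p ⟨
  + o - + p             ∎
  where open ℤ.≤-Reasoning

module _ {c ℓ₁ ℓ₂ : Level} (P : Preorder c ℓ₁ ℓ₂) where
  open Preorder P using (Carrier; _≲_) renaming (refl to ≲-refl; trans to ≲-trans)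

  antitone-by-steps : ∀ {n} (f : Fin n → Carrier) → (∀ a b → toℕ b ≡ suc (toℕ a) → f b ≲ f a) →
                      ∀ i j → i Fin.≤ j → f j ≲ f i
  antitone-by-steps f step Fin.zero Fin.zero _ = ≲-refl
  antitone-by-steps f step Fin.zero (Fin.suc Fin.zero) _ = step Fin.zero (Fin.suc Fin.zero) refl
  antitone-by-steps f step Fin.zero (Fin.suc (Fin.suc j)) _ =
    ≲-trans (antitone-by-steps (f ∘ Fin.suc) step∘suc Fin.zero (Fin.suc j) z≤n) (step Fin.zero (Fin.suc Fin.zero) refl)
    where step∘suc = λ a b e → step (Fin.suc a) (Fin.suc b) (cong suc e)
  antitone-by-steps f step (Fin.suc i) (Fin.suc j) (s≤s i≤j) = antitone-by-steps (f ∘ Fin.suc) step∘suc i j i≤j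
    where step∘suc = λ a b e → step (Fin.suc a) (Fin.suc b) (cong suc e)

≤-last : ∀ {n} (i : Fin n) → Σ[ l ∈ Fin n ] (i Fin.≤ l × suc (toℕ l) ≡ n)
≤-last {suc m} i = fromℕ m , ≤fromℕ i , cong suc (toℕ-fromℕ m)

module _ {n : ℕ} where

  sval-pos : (ρ : SignedPerm n) (i : Fin n) → ℤ.+0 ℤ.< sval ρ i → sval ρ i ≡ + suc (toℕ (absIdx ρ i))
  sval-pos ρ i with neg ρ i
  ... | false = λ _ → refl
  ... | true  = λ ()

  sval-nonpos : (ρ : SignedPerm n) (i : Fin n) → ¬ (ℤ.+0 ℤ.< sval ρ i) → sval ρ i ≡ -[1+ toℕ (absIdx ρ i) ]
  sval-nonpos ρ i with neg ρ i
  ... | false = λ ¬pos → contradiction (+<+ ℕ.z<s) ¬pos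
  ... | true  = λ _ → refl

  sinv-pos⇔pos : (σ : SignedPerm n) (j : Fin n) →
                 ℤ.+0 ℤ.< sval (sinv σ) j ⇔ ℤ.+0 ℤ.< sval σ (perm σ ⟨$⟩ˡ j)
  sinv-pos⇔pos σ j with neg σ (perm σ ⟨$⟩ˡ j)
  ... | false = mk⇔ (λ _ → +<+ ℕ.z<s) (λ _ → +<+ ℕ.z<s)
  ... | true  = mk⇔ (λ ()) (λ ())

  val-suc-toℕ : (ρ : SignedPerm n) (i : Fin n) → val ρ (suc (toℕ i)) ≡ sval ρ i
  val-suc-toℕ ρ i with toℕ i <? n
  ... | yes i<n = cong (sval ρ) (fromℕ<-toℕ i i<n)
  ... | no  i≮n = contradiction (toℕ<n i) i≮n

  descent⇒sval-> : (ρ : SignedPerm n) (a b : Fin n) → toℕ b ≡ suc (toℕ a) →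
                   IsDes ρ (suc (toℕ a)) → sval ρ b ℤ.< sval ρ a
  descent⇒sval-> ρ a b b≡a+1 (_ , _ , des) =
    subst₂ ℤ._<_ (trans (cong (λ k → val ρ (suc k)) (sym b≡a+1)) (val-suc-toℕ ρ b)) (val-suc-toℕ ρ a) des

  εStat-pos : (ρ : SignedPerm n) (k : ℕ) → ℤ.+0 ℤ.< val ρ k → εStat ρ k ≡ 0
  εStat-pos ρ k pos with ℤ.+0 ℤ.<? val ρ k
  ... | yes _    = refl
  ... | no  ¬pos = contradiction pos ¬pos

  εStat-nonpos : (ρ : SignedPerm n) (k : ℕ) → ¬ (ℤ.+0 ℤ.< val ρ k) → εStat ρ k ≡ 1
  εStat-nonpos ρ k ¬pos with ℤ.+0 ℤ.<? val ρ k
  ... | yes pos = contradiction pos ¬pos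
  ... | no  _   = refl

  dStat-suc-≤ : (ρ : SignedPerm n) (i : ℕ) → dStat ρ i ℕ.≤ suc (dStat ρ (suc i))
  dStat-suc-≤ ρ i = length-atLeast-suc (isDes? ρ) (upTo⁺ n)

  dStat-suc-≡ : (ρ : SignedPerm n) (i : ℕ) → ¬ IsDes ρ i → dStat ρ i ≡ dStat ρ (suc i)
  dStat-suc-≡ ρ i ¬des = cong length (atLeast-suc (isDes? ρ) (upTo n)
    (All.universal (λ j des j≡i → ¬des (subst (IsDes ρ) j≡i des)) (upTo n)))

  dStat-≥ : (ρ : SignedPerm n) (i : ℕ) → n ℕ.≤ i → dStat ρ i ≡ 0
  dStat-≥ ρ i n≤i = cong length (filter-none (λ j → isDes? ρ j ×-dec (i ≤? j))
    (All.universal (λ j ((1≤j , j≤n-1 , _) , i≤j) → beyond n j 1≤j j≤n-1 (ℕ.≤-trans n≤i i≤j)) (upTo n)))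
    where
    beyond : ∀ m j → 1 ℕ.≤ j → j ℕ.≤ m ∸ 1 → m ℕ.≤ j → ⊥
    beyond zero    j 1≤j j≤0 _   = <⇒≱ 1≤j j≤0
    beyond (suc m) j _   j≤m m<j = <⇒≱ m<j j≤m

𝔰-even : ∀ {a} → 2 ℕ∣.∣ a → 𝔰 a ≡ + a
𝔰-even {a} 2∣a with 2 ∣? a
... | yes _   = refl
... | no ¬2∣a = contradiction 2∣a ¬2∣a

𝔰-odd : ∀ {a} → ¬ 2 ℕ∣.∣ a → 𝔰 a ≡ - + a
𝔰-odd {a} ¬2∣a with 2 ∣? a
... | yes 2∣a = contradiction 2∣a ¬2∣a
... | no _    = refl

module SignedIndexPermutation {n : ℕ} {p q : Fin n → ℕ} (pq∈𝒪 : InO n p q)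
                              (σ : SignedPerm n) (σ-sip : IsSignedIndexPerm q σ) where

  τ : SignedPerm n
  τ = sinv σ

  -- r j is the (0-based) position at which σ places ±(j+1), so |τ(j+1)| = r j + 1.
  r : Fin n → Fin n
  r j = perm σ ⟨$⟩ˡ j

  absIdx-r : ∀ j → absIdx σ (r j) ≡ j
  absIdx-r j = inverseʳ (perm σ)

  r-injective : ∀ {a b} → toℕ (r a) ≡ toℕ (r b) → a ≡ b
  r-injective {a} {b} eq = trans (sym (absIdx-r a)) (trans (cong (absIdx σ) (toℕ-injective eq)) (absIdx-r b))

  even-p⇔even-q : ∀ j → 2 ℕ∣.∣ p j ⇔ 2 ℕ∣.∣ q j
  even-p⇔even-q j = mk⇔ (∣m+n∣m⇒∣n (proj₁ pq∈𝒪 j))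
                        (∣m+n∣m⇒∣n (subst (2 ℕ∣.∣_) (+-comm (p j) (q j)) (proj₁ pq∈𝒪 j)))

  q-antitone : ∀ x y → toℕ (r x) ℕ.≤ toℕ (r y) → q y ℕ.≤ q x
  q-antitone x y rx≤ry = subst₂ (λ u v → q u ℕ.≤ q v) (absIdx-r y) (absIdx-r x) (proj₁ σ-sip (r x) (r y) rx≤ry)

  σ-increasing-on-ties : ∀ {x y} → q x ≡ q y → toℕ (r x) ℕ.< toℕ (r y) → sval σ (r x) ℤ.< sval σ (r y)
  σ-increasing-on-ties {x} {y} qx≡qy rx<ry =
    proj₁ (proj₂ σ-sip) (r x) (r y) rx<ry (subst₂ (λ u v → q u ≡ q v) (sym (absIdx-r x)) (sym (absIdx-r y)) qx≡qy)
                        (r x) (r y) ≤-refl rx<ry ≤-refl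

  σr-pos⇔even : ∀ j → ℤ.+0 ℤ.< sval σ (r j) ⇔ 2 ℕ∣.∣ q j
  σr-pos⇔even j = mk⇔ (subst (λ k → 2 ℕ∣.∣ q k) (absIdx-r j) ∘ proj₂ (proj₂ (proj₂ σ-sip) (r j)))
                      (proj₁ (proj₂ (proj₂ σ-sip) (r j)) ∘ subst (λ k → 2 ℕ∣.∣ q k) (sym (absIdx-r j)))

  τ-pos⇔even : ∀ j → ℤ.+0 ℤ.< sval τ j ⇔ 2 ℕ∣.∣ q j
  τ-pos⇔even j = ⇔-trans (sinv-pos⇔pos σ j) (σr-pos⇔even j)

  τ-even : ∀ {j} → 2 ℕ∣.∣ q j → sval τ j ≡ + suc (toℕ (r j))
  τ-even {j} = sval-pos τ j ∘ Equivalence.from (τ-pos⇔even j)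

  τ-odd : ∀ {j} → ¬ 2 ℕ∣.∣ q j → sval τ j ≡ -[1+ toℕ (r j) ]
  τ-odd {j} odd = sval-nonpos τ j (odd ∘ Equivalence.to (τ-pos⇔even j))

  σr-even : ∀ {j} → 2 ℕ∣.∣ q j → sval σ (r j) ≡ + suc (toℕ j)
  σr-even {j} even = trans (sval-pos σ (r j) (Equivalence.from (σr-pos⇔even j) even))
                           (cong (λ k → + suc (toℕ k)) (absIdx-r j))

  σr-odd : ∀ {j} → ¬ 2 ℕ∣.∣ q j → sval σ (r j) ≡ -[1+ toℕ j ]
  σr-odd {j} odd = trans (sval-nonpos σ (r j) (odd ∘ Equivalence.to (σr-pos⇔even j)))
                         (cong (λ k → -[1+ toℕ k ]) (absIdx-r j))

  ascent-even : ∀ {a b} → toℕ a ℕ.< toℕ b → 2 ℕ∣.∣ q a → 2 ℕ∣.∣ q b → q b ℕ.≤ q a → sval τ a ℤ.< sval τ b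
  ascent-even {a} {b} a<b ea eb qb≤qa with <-cmp (toℕ (r a)) (toℕ (r b))
  ... | tri< ra<rb _ _ = subst₂ ℤ._<_ (sym (τ-even ea)) (sym (τ-even eb)) (+<+ (ℕ.s<s ra<rb))
  ... | tri≈ _ ra≡rb _ = contradiction (cong toℕ (r-injective ra≡rb)) (<⇒≢ a<b)
  ... | tri> _ _ rb<ra = contradiction (ℕ.s<s⁻¹ (ℤ.drop‿+<+ σrb<σra)) (<-asym a<b)
    where
    σrb<σra = subst₂ ℤ._<_ (σr-even eb) (σr-even ea)
                (σ-increasing-on-ties (≤-antisym qb≤qa (q-antitone b a (<⇒≤ rb<ra))) rb<ra)

  ascent-odd : ∀ {a b} → toℕ a ℕ.< toℕ b → ¬ 2 ℕ∣.∣ q a → ¬ 2 ℕ∣.∣ q b → q a ℕ.≤ q b → sval τ a ℤ.< sval τ b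
  ascent-odd {a} {b} a<b oa ob qa≤qb with <-cmp (toℕ (r a)) (toℕ (r b))
  ... | tri< ra<rb _ _ = contradiction (ℤ.drop‿-<- σra<σrb) (<-asym a<b)
    where
    σra<σrb = subst₂ ℤ._<_ (σr-odd oa) (σr-odd ob)
                (σ-increasing-on-ties (≤-antisym qa≤qb (q-antitone a b (<⇒≤ ra<rb))) ra<rb)
  ... | tri≈ _ ra≡rb _ = contradiction (cong toℕ (r-injective ra≡rb)) (<⇒≢ a<b)
  ... | tri> _ _ rb<ra = subst₂ ℤ._<_ (sym (τ-odd oa)) (sym (τ-odd ob)) (-<- rb<ra)

  ascent-odd-even : ∀ {a b} → ¬ 2 ℕ∣.∣ q a → 2 ℕ∣.∣ q b → sval τ a ℤ.< sval τ b
  ascent-odd-even oa eb = subst₂ ℤ._<_ (sym (τ-odd oa)) (sym (τ-even eb)) -<+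

  ascent-unless-halves-drop : ∀ {a b} → toℕ a ℕ.< toℕ b → p a / 2 ℕ.≤ p b / 2 → sval τ a ℤ.< sval τ b
  ascent-unless-halves-drop {a} {b} a<b pa/2≤pb/2 with proj₂ pq∈𝒪 a b (<⇒≤ a<b)
  ... | inj₁ pb<pa =
    let ep , op = m<n∧n/2≤m/2⇒2∣m∧2∤n pb<pa pa/2≤pb/2
    in ascent-odd-even (op ∘ Equivalence.from (even-p⇔even-q a)) (Equivalence.to (even-p⇔even-q b) ep)
  ... | inj₂ (pa≡pb , 𝔰qb≤𝔰qa) = tie (2 ∣? q a)
    where
    tie : Dec (2 ℕ∣.∣ q a) → sval τ a ℤ.< sval τ b
    tie (yes ea) = ascent-even a<b ea eb (ℤ.drop‿+≤+ (subst₂ ℤ._≤_ (𝔰-even eb) (𝔰-even ea) 𝔰qb≤𝔰qa))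
      where eb = Equivalence.to (even-p⇔even-q b) (subst (2 ℕ∣.∣_) pa≡pb (Equivalence.from (even-p⇔even-q a) ea))
    tie (no oa) = ascent-odd a<b oa ob
                    (ℤ.drop‿+≤+ (ℤ.neg-cancel-≤ (subst₂ ℤ._≤_ (𝔰-odd ob) (𝔰-odd oa) 𝔰qb≤𝔰qa)))
      where ob = oa ∘ Equivalence.to (even-p⇔even-q a) ∘ subst (2 ℕ∣.∣_) (sym pa≡pb) ∘ Equivalence.from (even-p⇔even-q b)

  d : Fin n → ℕ
  d a = dStat τ (suc (toℕ a))

  slack : Fin n → ℤ
  slack a = + (p a / 2) - + d a

  halves-drop-at-descent : ∀ a b → toℕ b ≡ suc (toℕ a) → IsDes τ (suc (toℕ a)) → p b / 2 ℕ.< p a / 2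
  halves-drop-at-descent a b b≡a+1 des with p b / 2 ℕ.<? p a / 2
  ... | yes drop = drop
  ... | no ¬drop = contradiction (descent⇒sval-> τ a b b≡a+1 des)
                     (ℤ.<-asym (ascent-unless-halves-drop (subst (toℕ a ℕ.<_) (sym b≡a+1) ≤-refl) (≮⇒≥ ¬drop)))

  slack-step : ∀ a b → toℕ b ≡ suc (toℕ a) → slack b ℤ.≤ slack a
  slack-step a b b≡a+1 =
    m-n≤o-p {p b / 2} {d b} {p a / 2} {d a}
      (subst (λ k → d a + p b / 2 ℕ.≤ dStat τ (suc k) + p a / 2) (sym b≡a+1) (cross (isDes? τ (suc (toℕ a)))))
    where
    open ℕ.≤-Reasoning
    d′ = dStat τ (suc (suc (toℕ a)))
    pb/2≤pa/2 : p b / 2 ℕ.≤ p a / 2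
    pb/2≤pa/2 with proj₂ pq∈𝒪 a b (subst (toℕ a ℕ.≤_) (sym b≡a+1) (n≤1+n _))
    ... | inj₁ pb<pa      = /-monoˡ-≤ 2 (<⇒≤ pb<pa)
    ... | inj₂ (pa≡pb , _) = ℕ.≤-reflexive (cong (_/ 2) (sym pa≡pb))
    cross : Dec (IsDes τ (suc (toℕ a))) → d a + p b / 2 ℕ.≤ d′ + p a / 2
    cross (yes des) = begin
      d a + p b / 2       ≤⟨ +-monoˡ-≤ (p b / 2) (dStat-suc-≤ τ (suc (toℕ a))) ⟩
      suc d′ + p b / 2    ≡⟨ +-suc d′ (p b / 2) ⟨
      d′ + suc (p b / 2)  ≤⟨ +-monoʳ-≤ d′ (halves-drop-at-descent a b b≡a+1 des) ⟩
      d′ + p a / 2        ∎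
    cross (no ¬des) = +-mono-≤ (ℕ.≤-reflexive (dStat-suc-≡ τ (suc (toℕ a)) ¬des)) pb/2≤pa/2

  slack-antitone : ∀ i j → i Fin.≤ j → slack j ℤ.≤ slack i
  slack-antitone = antitone-by-steps ℤ.≤-preorder slack slack-step

  slack-last : ∀ l → suc (toℕ l) ≡ n → ℤ.+0 ℤ.≤ slack l
  slack-last l l-last = subst (λ k → ℤ.+0 ℤ.≤ + (p l / 2) - + k)
                              (sym (dStat-≥ τ (suc (toℕ l)) (ℕ.≤-reflexive (sym l-last)))) (ℤ.+≤+ z≤n)

  slack-nonneg : ∀ i → ℤ.+0 ℤ.≤ slack i
  slack-nonneg i = let l , i≤l , l-last = ≤-last i in ℤ.≤-trans (slack-last l l-last) (slack-antitone i l i≤l)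

  εStat-parity : ∀ a → εStat τ (suc (toℕ a)) ≡ p a % 2
  εStat-parity a with 2 ∣? p a
  ... | yes ep = trans (εStat-pos τ _ (subst (ℤ.+0 ℤ.<_) (sym (val-suc-toℕ τ a)) τa>0)) (sym (n∣m⇒m%n≡0 (p a) 2 ep))
    where τa>0 = Equivalence.from (τ-pos⇔even a) (Equivalence.to (even-p⇔even-q a) ep)
  ... | no op  = trans (εStat-nonpos τ _ (τa≯0 ∘ subst (ℤ.+0 ℤ.<_) (val-suc-toℕ τ a))) (sym (¬2∣m⇒m%2≡1 op))
    where τa≯0 = op ∘ Equivalence.from (even-p⇔even-q a) ∘ Equivalence.to (τ-pos⇔even a)

  excess : Fin n → ℤ
  excess a = + p a - + fStat τ (suc (toℕ a))

  excess≡slack*2 : ∀ a → excess a ≡ slack a ℤ.* + 2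
  excess≡slack*2 a = trans (cong (λ e → + p a - + (2 * d a + e)) (εStat-parity a)) (m-[2d+m%2]≡[m/2-d]*2 (p a) (d a))

  excess-nonneg : ∀ a → + 0 ℤ.≤ excess a
  excess-nonneg a = subst (+ 0 ℤ.≤_) (sym (excess≡slack*2 a)) (ℤ.*-monoʳ-≤-nonNeg (+ 2) (slack-nonneg a))

  excess-even : ∀ a → + 2 ∣ excess a
  excess-even a = subst (+ 2 ∣_) (sym (excess≡slack*2 a)) (*-monoˡ-∣ (+ 2) {+ 1} {slack a} (1∣ ℤ.∣ slack a ∣))

  excess-antitone : ∀ i j → i Fin.≤ j → excess j ℤ.≤ excess i
  excess-antitone i j i≤j = subst₂ ℤ._≤_ (sym (excess≡slack*2 j)) (sym (excess≡slack*2 i))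
                              (ℤ.*-monoʳ-≤-nonNeg (+ 2) (slack-antitone i j i≤j))

mainTheorem4 : (n : ℕ) (p q : Fin n → ℕ) → InO n p q →
    (σ : SignedPerm n) → IsSignedIndexPerm q σ →
    (∀ (i : Fin n) → (+ 0 ℤ.≤ + p i - + fStat (sinv σ) (suc (toℕ i)))
                   × (+ 2 ∣ + p i - + fStat (sinv σ) (suc (toℕ i)))) ×
    (∀ (i j : Fin n) → i Fin.≤ j →
       + p j - + fStat (sinv σ) (suc (toℕ j)) ℤ.≤ + p i - + fStat (sinv σ) (suc (toℕ i)))
mainTheorem4 n p q pq∈𝒪 σ σ-sip = (λ i → excess-nonneg i , excess-even i) , excess-antitone
  where open SignedIndexPermutation pq∈𝒪 σ σ-sip
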